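{- The graph $F(8,12,3)$ on vertex set $\{1,\dots,8\}$ with edges $\{1,2\},\{2,4\},\{3,4\},\{1,3\},\{3,5\},\{5,7\},\{7,8\},\{6,8\},\{4,6\},\{5,6\},\{1,8\},\{2,7\}$ is forbidden.
   Context: All graphs are finite and simple. A graph $G$ with vertex set $V$ is unit-distance if there exists an injective map $\varphi\colon V\to\mathbf{R}^2$ with $|\varphi(v)-\varphi(w)|=1$ for every pair of adjacent vertices $v,w$ (non-adjacent vertices may also be at distance 1). A graph is forbidden if it is not unit-distance. -}

module Defs where

open import Level using (Level; _⊔_) renaming (suc to lsuc)
open import Algebra.Bundles using (CommutativeRing)
open import Relation.Binary.Structures using (IsStrictTotalOrder)
open import Data.Product using (Σ; ∃; _×_; _,_; proj₁; proj₂)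
open import Data.Sum using (_⊎_; inj₁; inj₂)
open import Data.Fin using (Fin; zero; suc)
open import Data.Nat using (ℕ)
open import Data.List using (List; []; _∷_)
open import Data.List.Membership.Propositional using (_∈_)
open import Data.List.Relation.Unary.Any using (here; there)
open import Relation.Binary.PropositionalEquality using (_≡_)
open import Relation.Nullary using (¬_)

-- The real numbers, given axiomatically as a Dedekind-complete
-- ordered field (unique up to isomorphism).  Statements quantify over
-- every such structure.

record RealField (c ℓ₁ ℓ₂ : Level) : Set (lsuc (c ⊔ ℓ₁ ⊔ ℓ₂)) where
  field
    commutativeRing : CommutativeRing c ℓ₁
  open CommutativeRing commutativeRing public
  field
    _<_ : Carrier → Carrier → Set ℓ₂
    <-isStrictTotalOrder : IsStrictTotalOrder _≈_ _<_
    0≉1     : ¬ (0# ≈ 1#)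
    inverse : ∀ x → ¬ (x ≈ 0#) → Σ Carrier (λ y → (x * y) ≈ 1#)
    +-mono-< : ∀ {x y} z → x < y → (x + z) < (y + z)
    *-pos   : ∀ {x y} → 0# < x → 0# < y → 0# < (x * y)
  _≤_ : Carrier → Carrier → Set (ℓ₁ ⊔ ℓ₂)
  x ≤ y = (x < y) ⊎ (x ≈ y)
  IsUpperBound : (Carrier → Set (c ⊔ ℓ₁ ⊔ ℓ₂)) → Carrier → Set (c ⊔ ℓ₁ ⊔ ℓ₂)
  IsUpperBound P b = ∀ x → P x → x ≤ b
  field
    lub : (P : Carrier → Set (c ⊔ ℓ₁ ⊔ ℓ₂)) → Σ Carrier P →
          Σ Carrier (IsUpperBound P) →
          Σ Carrier (λ s → IsUpperBound P s × (∀ b → IsUpperBound P b → s ≤ b))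

record Graph (n : ℕ) : Set₁ where
  field
    Adj     : Fin n → Fin n → Set
    sym     : ∀ {v w} → Adj v w → Adj w v
    irrefl  : ∀ {v} → ¬ Adj v v

module _ {c ℓ₁ ℓ₂} (R : RealField c ℓ₁ ℓ₂) where
  open RealField R

  Point : Set c
  Point = Carrier × Carrier

  _≈ₚ_ : Point → Point → Set ℓ₁
  (x₁ , y₁) ≈ₚ (x₂ , y₂) = (x₁ ≈ x₂) × (y₁ ≈ y₂)

  dist² : Point → Point → Carrier
  dist² (x₁ , y₁) (x₂ , y₂) =
    ((x₁ - x₂) * (x₁ - x₂)) + ((y₁ - y₂) * (y₁ - y₂))

  -- |p - q| = 1  iff  |p - q|² = 1 (distances are nonnegative)
  UnitDistance : ∀ {n} → Graph n → Set (c ⊔ ℓ₁)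
  UnitDistance {n} G =
    Σ (Fin n → Point) λ φ →
      (∀ v w → φ v ≈ₚ φ w → v ≡ w) ×
      (∀ v w → Graph.Adj G v w → dist² (φ v) (φ w) ≈ 1#)

  Forbidden : ∀ {n} → Graph n → Set (c ⊔ ℓ₁)
  Forbidden G = ¬ UnitDistance G

-- The graph F(8,12,3).  Vertex i ∈ {1,…,8} is represented by Fin 8
-- element i-1.

v1 v2 v3 v4 v5 v6 v7 v8 : Fin 8
v1 = zero
v2 = suc zero
v3 = suc (suc zero)
v4 = suc (suc (suc zero))
v5 = suc (suc (suc (suc zero)))
v6 = suc (suc (suc (suc (suc zero))))
v7 = suc (suc (suc (suc (suc (suc zero)))))
v8 = suc (suc (suc (suc (suc (suc (suc zero))))))

F-8-12-3-edges : List (Fin 8 × Fin 8)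
F-8-12-3-edges =
  (v1 , v2) ∷ (v2 , v4) ∷ (v3 , v4) ∷ (v1 , v3) ∷ (v3 , v5) ∷ (v5 , v7) ∷
  (v7 , v8) ∷ (v6 , v8) ∷ (v4 , v6) ∷ (v5 , v6) ∷ (v1 , v8) ∷ (v2 , v7) ∷ []

F-Adj : Fin 8 → Fin 8 → Set
F-Adj v w = ((v , w) ∈ F-8-12-3-edges) ⊎ ((w , v) ∈ F-8-12-3-edges)

F-sym : ∀ {v w} → F-Adj v w → F-Adj w v
F-sym (inj₁ p) = inj₂ p
F-sym (inj₂ p) = inj₁ p

private
  no-loop : ∀ {v} → ¬ ((v , v) ∈ F-8-12-3-edges)
  no-loop (there (there (there (there (there (there (there (there (there (there (there (there ())))))))))))) 

F-irrefl : ∀ {v} → ¬ F-Adj v v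
F-irrefl (inj₁ p) = no-loop p
F-irrefl (inj₂ p) = no-loop p

F-8-12-3 : Graph 8
F-8-12-3 = record { Adj = F-Adj ; sym = F-sym ; irrefl = F-irrefl }

module Submission where

-- If a 4-cycle PQRS is drawn with four sides of equal length and
-- P ≠ R, Q ≠ S, it is a rhombus, hence a parallelogram: Q - P = R - S.
-- In F(8,12,3) the 4-cycles 1243, 3465, 5687 chain together, so the edge
-- vector 2 - 1 equals 8 - 7, while the 4-cycle 1278 gives 2 - 1 = 7 - 8.
-- Hence 2 - 1 = 0, contradicting injectivity of the embedding.

open import Defs
open import Algebra.Bundles using (CommutativeRing)
import Algebra.Solver.Ring as RingSolver
open import Algebra.Solver.Ring.AlmostCommutativeRing using (fromCommutativeRing; _-Raw-AlmostCommutative⟶_)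
open import Data.Fin as Fin using (Fin)
open import Data.Integer as ℤ using (ℤ; +_; -[1+_])
open import Data.Integer.Properties using ([1+m]⊖[1+n]≡m⊖n)
import Data.List.Membership.DecPropositional
open import Data.Maybe using (Maybe; just; nothing)
open import Data.Nat as ℕ using (ℕ; zero; suc)
open import Data.Nat.Properties using (+-suc)
open import Data.Product using (_×_; _,_; proj₁; proj₂)
open import Data.Product.Properties using (≡-dec)
import Data.Sign as Sign
open import Data.Sum using (inj₁; inj₂)
open import Relation.Binary.Definitions using (tri<; tri≈; tri>)
open import Relation.Binary.PropositionalEquality as ≡ using (_≡_)
open import Relation.Binary.Structures using (IsStrictTotalOrder)
open import Relation.Nullary using (¬_; Dec; yes; no; contradiction)
open import Relation.Nullary.Decidable using (True; toWitness; _⊎-dec_)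

-- The ring solver needs coefficients whose equality can be decided by
-- computation; we take ℤ and interpret it in an arbitrary commutative
-- ring through the canonical homomorphism n ↦ n·1.
module IntegerCoefficients {c ℓ} (CR : CommutativeRing c ℓ) where
  open CommutativeRing CR
  open import Algebra.Properties.Ring ring
    using (-0#≈0#; -‿involutive; -‿+-comm; -‿distribˡ-*; -‿distribʳ-*)
  open import Algebra.Properties.Semiring.Mult semiring
    using (×-congˡ; ×-homo-+; ×1-homo-*) renaming (_×_ to _·_)
  open import Relation.Binary.Reasoning.Setoid setoid

  ⟦_⟧ : ℤ → Carrier
  ⟦ + n ⟧      = n · 1#
  ⟦ -[1+ n ] ⟧ = - (suc n · 1#)

  difference-shift : ∀ x a b → (x + a) - (x + b) ≈ a - b
  difference-shift x a b = begin
    (x + a) - (x + b)       ≈⟨ +-congˡ (-‿+-comm x b) ⟨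
    (x + a) + (- x + - b)   ≈⟨ +-congʳ (+-comm x a) ⟩
    (a + x) + (- x + - b)   ≈⟨ +-assoc a x _ ⟩
    a + (x + (- x + - b))   ≈⟨ +-congˡ (+-assoc x (- x) (- b)) ⟨
    a + ((x - x) + - b)     ≈⟨ +-congˡ (+-congʳ (-‿inverseʳ x)) ⟩
    a + (0# + - b)          ≈⟨ +-congˡ (+-identityˡ (- b)) ⟩
    a - b                   ∎

  ⊖-homo : ∀ m n → ⟦ m ℤ.⊖ n ⟧ ≈ m · 1# - n · 1#
  ⊖-homo m       zero    = sym (trans (+-congˡ -0#≈0#) (+-identityʳ _))
  ⊖-homo zero    (suc n) = sym (+-identityˡ _)
  ⊖-homo (suc m) (suc n) rewrite [1+m]⊖[1+n]≡m⊖n m n =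
    trans (⊖-homo m n) (sym (difference-shift 1# (m · 1#) (n · 1#)))

  +-homo : ∀ i j → ⟦ i ℤ.+ j ⟧ ≈ ⟦ i ⟧ + ⟦ j ⟧
  +-homo -[1+ m ] -[1+ n ] = begin
    - (suc (suc (m ℕ.+ n)) · 1#)       ≈⟨ -‿cong (×-congˡ (≡.cong suc (+-suc m n))) ⟨
    - ((suc m ℕ.+ suc n) · 1#)         ≈⟨ -‿cong (×-homo-+ 1# (suc m) (suc n)) ⟩
    - (suc m · 1# + suc n · 1#)        ≈⟨ -‿+-comm _ _ ⟨
    - (suc m · 1#) + - (suc n · 1#)    ∎
  +-homo -[1+ m ] (+ n)    = trans (⊖-homo n (suc m)) (+-comm _ _)
  +-homo (+ m)    -[1+ n ] = ⊖-homo m (suc n)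
  +-homo (+ m)    (+ n)    = ×-homo-+ 1# m n

  neg-homo : ∀ i → ⟦ ℤ.- i ⟧ ≈ - ⟦ i ⟧
  neg-homo (+ zero)  = sym -0#≈0#
  neg-homo (+ suc n) = refl
  neg-homo -[1+ n ]  = sym (-‿involutive _)

  -- Images of signed magnitudes, through which ℤ's product is defined.
  ◃-homo₊ : ∀ k → ⟦ Sign.+ ℤ.◃ k ⟧ ≈ k · 1#
  ◃-homo₊ zero    = refl
  ◃-homo₊ (suc k) = refl

  ◃-homo₋ : ∀ k → ⟦ Sign.- ℤ.◃ k ⟧ ≈ - (k · 1#)
  ◃-homo₋ zero    = sym -0#≈0#
  ◃-homo₋ (suc k) = refl

  *-homo : ∀ i j → ⟦ i ℤ.* j ⟧ ≈ ⟦ i ⟧ * ⟦ j ⟧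
  *-homo (+ m) (+ n) = trans (◃-homo₊ (m ℕ.* n)) (×1-homo-* m n)
  *-homo (+ m) -[1+ n ] = begin
    ⟦ Sign.- ℤ.◃ (m ℕ.* suc n) ⟧      ≈⟨ ◃-homo₋ (m ℕ.* suc n) ⟩
    - ((m ℕ.* suc n) · 1#)            ≈⟨ -‿cong (×1-homo-* m (suc n)) ⟩
    - (m · 1# * suc n · 1#)           ≈⟨ -‿distribʳ-* _ _ ⟩
    m · 1# * - (suc n · 1#)           ∎
  *-homo -[1+ m ] (+ n) = begin
    ⟦ Sign.- ℤ.◃ (suc m ℕ.* n) ⟧      ≈⟨ ◃-homo₋ (suc m ℕ.* n) ⟩
    - ((suc m ℕ.* n) · 1#)            ≈⟨ -‿cong (×1-homo-* (suc m) n) ⟩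
    - (suc m · 1# * n · 1#)           ≈⟨ -‿distribˡ-* _ _ ⟩
    - (suc m · 1#) * n · 1#           ∎
  *-homo -[1+ m ] -[1+ n ] = begin
    ⟦ Sign.+ ℤ.◃ (suc m ℕ.* suc n) ⟧  ≈⟨ ◃-homo₊ (suc m ℕ.* suc n) ⟩
    (suc m ℕ.* suc n) · 1#            ≈⟨ ×1-homo-* (suc m) (suc n) ⟩
    a * b                             ≈⟨ -‿involutive _ ⟨
    - - (a * b)                       ≈⟨ -‿cong (-‿distribˡ-* a b) ⟩
    - (- a * b)                       ≈⟨ -‿distribʳ-* (- a) b ⟩
    - a * - b                         ∎
    where
    a b : Carrier
    a = suc m · 1#
    b = suc n · 1#

  homomorphism : ℤ.+-*-rawRing -Raw-AlmostCommutative⟶ fromCommutativeRing CR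
  homomorphism = record
    { ⟦_⟧ = ⟦_⟧ ; +-homo = +-homo ; *-homo = *-homo ; -‿homo = neg-homo
    ; 0-homo = refl ; 1-homo = +-identityʳ 1# }

  coefficient-equality : ∀ i j → Maybe (⟦ i ⟧ ≈ ⟦ j ⟧)
  coefficient-equality i j with i ℤ.≟ j
  ... | yes ≡.refl = just refl
  ... | no _       = nothing

  open RingSolver ℤ.+-*-rawRing (fromCommutativeRing CR) homomorphism coefficient-equality public
    using (Polynomial; solve; _:=_; _:+_; _:*_; :-_; con)

-- Coordinate vector algebra in the plane, written once over an arbitrary
-- signature (+, *, -) so that the same formulas can be read both in a
-- field and as ring-solver polynomials.
module PlaneVectors {a} {A : Set a} (_+_ _*_ : A → A → A) (-_ : A → A) where
  infixl 6 _⊖_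
  infix  7 _∙_

  Vector : Set a
  Vector = A × A

  _⊖_ : Vector → Vector → Vector
  (x₁ , y₁) ⊖ (x₂ , y₂) = ((x₁ + (- x₂)) , (y₁ + (- y₂)))

  _∙_ cross : Vector → Vector → A
  (x₁ , y₁) ∙ (x₂ , y₂) = (x₁ * x₂) + (y₁ * y₂)
  cross (x₁ , y₁) (x₂ , y₂) = (x₁ * y₂) + (- (y₁ * x₂))

  -- squared length; ∣ p ⊖ q ∣² is the squared distance dist² of Defs
  ∣_∣² : Vector → A
  ∣ v ∣² = v ∙ v

module OrderedFieldFacts {c ℓ₁ ℓ₂} (R : RealField c ℓ₁ ℓ₂) where
  open RealField R
  open import Algebra.Properties.Ring ring using (-‿distribˡ-*; -‿distribʳ-*; -‿involutive)
  open import Relation.Binary.Reasoning.Setoid setoid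
  private module < = IsStrictTotalOrder <-isStrictTotalOrder

  cancel-nonzero : ∀ {x y} → x * y ≈ 0# → ¬ x ≈ 0# → y ≈ 0#
  cancel-nonzero {x} {y} xy≈0 x≉0 with inverse x x≉0
  ... | x⁻¹ , xx⁻¹≈1 = begin
    y              ≈⟨ *-identityˡ y ⟨
    1# * y         ≈⟨ *-congʳ (trans (sym xx⁻¹≈1) (*-comm x x⁻¹)) ⟩
    (x⁻¹ * x) * y  ≈⟨ *-assoc x⁻¹ x y ⟩
    x⁻¹ * (x * y)  ≈⟨ *-congˡ xy≈0 ⟩
    x⁻¹ * 0#       ≈⟨ zeroʳ x⁻¹ ⟩
    0#             ∎

  nonzero-product : ∀ {x y} → ¬ x ≈ 0# → ¬ y ≈ 0# → ¬ x * y ≈ 0#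
  nonzero-product x≉0 y≉0 xy≈0 = y≉0 (cancel-nonzero xy≈0 x≉0)

  negative⇒-positive : ∀ {x} → x < 0# → 0# < (- x)
  negative⇒-positive {x} x<0 =
    <.<-respʳ-≈ (+-identityˡ (- x)) (<.<-respˡ-≈ (-‿inverseʳ x) (+-mono-< (- x) x<0))

  square-positive : ∀ {x} → ¬ x ≈ 0# → 0# < (x * x)
  square-positive {x} x≉0 with <.compare 0# x
  ... | tri< 0<x _ _ = *-pos 0<x 0<x
  ... | tri≈ _ 0≈x _ = contradiction (sym 0≈x) x≉0
  ... | tri> _ _ x<0 =
    <.<-respʳ-≈ negated-square (*-pos (negative⇒-positive x<0) (negative⇒-positive x<0))
    where
    negated-square : (- x) * (- x) ≈ x * x
    negated-square = begin
      (- x) * (- x)  ≈⟨ -‿distribˡ-* x (- x) ⟨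
      - (x * (- x))  ≈⟨ -‿cong (-‿distribʳ-* x x) ⟨
      - (- (x * x))  ≈⟨ -‿involutive (x * x) ⟩
      x * x          ∎

  sum-of-squares-zero : ∀ {a b} → a * a + b * b ≈ 0# → a ≈ 0# × b ≈ 0#
  sum-of-squares-zero {a} {b} sum≈0 = zero-of a b sum≈0 , zero-of b a (trans (+-comm _ _) sum≈0)
    where
    nonnegative : ∀ x → 0# ≤ (x * x)
    nonnegative x with x <.≟ 0#
    ... | yes x≈0 = inj₂ (sym (trans (*-congʳ x≈0) (zeroˡ x)))
    ... | no x≉0  = inj₁ (square-positive x≉0)
    positive-sum : ∀ {x y} → 0# < x → 0# ≤ y → 0# < (x + y)
    positive-sum {x} {y} 0<x (inj₁ 0<y) =
      <.trans (<.<-respʳ-≈ (sym (+-identityˡ y)) 0<y) (+-mono-< y 0<x)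
    positive-sum {x} {y} 0<x (inj₂ 0≈y) =
      <.<-respˡ-≈ (trans (+-identityˡ y) (sym 0≈y)) (+-mono-< y 0<x)
    zero-of : ∀ x y → x * x + y * y ≈ 0# → x ≈ 0#
    zero-of x y s≈0 with x <.≟ 0#
    ... | yes x≈0 = x≈0
    ... | no x≉0  = contradiction (<.<-respʳ-≈ s≈0 (positive-sum (square-positive x≉0) (nonnegative y))) (<.irrefl refl)

  -- 2 ≠ 0, since 1 + 1 is a sum of nonzero squares; hence one may halve.
  half-zero : ∀ {x} → x + x ≈ 0# → x ≈ 0#
  half-zero {x} x+x≈0 = cancel-nonzero doubled two≉0
    where
    two≉0 : ¬ 1# + 1# ≈ 0#
    two≉0 2≈0 = 0≉1 (sym (proj₁ (sum-of-squares-zero (trans (+-cong (*-identityˡ 1#) (*-identityˡ 1#)) 2≈0))))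
    doubled : (1# + 1#) * x ≈ 0#
    doubled = trans (trans (distribʳ x 1# 1#) (+-cong (*-identityˡ x) (*-identityˡ x))) x+x≈0

module EuclideanPlane {c ℓ₁ ℓ₂} (R : RealField c ℓ₁ ℓ₂) where
  open RealField R
  open OrderedFieldFacts R
  open import Algebra.Properties.Ring ring using (x≈y⇒x∙y⁻¹≈ε; x∙y⁻¹≈ε⇒x≈y)
  open import Relation.Binary.Reasoning.Setoid setoid
  open IntegerCoefficients commutativeRing using (Polynomial; solve; _:=_; _:+_; _:*_; :-_; con)
  open PlaneVectors _+_ _*_ -_ public
  module Symbolic (n : ℕ) = PlaneVectors {A = Polynomial n} _:+_ _:*_ :-_

  infix 4 _≋_
  _≋_ : Vector → Vector → Set ℓ₁
  _≋_ = _≈ₚ_ R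

  𝟎 : Vector
  𝟎 = (0# , 0#)

  ≋-trans : ∀ {p q r} → p ≋ q → q ≋ r → p ≋ r
  ≋-trans (x₁ , y₁) (x₂ , y₂) = trans x₁ x₂ , trans y₁ y₂

  ≋-sym : ∀ {p q} → p ≋ q → q ≋ p
  ≋-sym (x , y) = sym x , sym y

  difference-zero : ∀ p q → p ⊖ q ≋ 𝟎 → p ≋ q
  difference-zero (p₁ , p₂) (q₁ , q₂) (d₁ , d₂) = x∙y⁻¹≈ε⇒x≈y p₁ q₁ d₁ , x∙y⁻¹≈ε⇒x≈y p₂ q₂ d₂

  binet-cauchy : ∀ u v w → ∣ u ∣² * (v ∙ w) ≈ (u ∙ v) * (u ∙ w) + cross u v * cross u w
  binet-cauchy (u₁ , u₂) (v₁ , v₂) (w₁ , w₂) =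
    solve 6 (λ u₁ u₂ v₁ v₂ w₁ w₂ →
      let u = (u₁ , u₂); v = (v₁ , v₂); w = (w₁ , w₂) in
      ∣ u ∣²′ :* (v ∙′ w) := ((u ∙′ v) :* (u ∙′ w)) :+ (cross′ u v :* cross′ u w))
      refl u₁ u₂ v₁ v₂ w₁ w₂
    where open Symbolic 6 using () renaming (_∙_ to _∙′_; cross to cross′; ∣_∣² to ∣_∣²′)

  norm²-zero : ∀ v → ∣ v ∣² ≈ 0# → v ≋ 𝟎
  norm²-zero (x , y) = sum-of-squares-zero

  zero-factor : ∀ {a} b → a ≈ 0# → a * b ≈ 0#
  zero-factor b a≈0 = trans (*-congʳ a≈0) (zeroˡ b)

  drop-zero-term : ∀ {x a b y} → x ≈ a * b + y → a ≈ 0# → x ≈ y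
  drop-zero-term {x} {a} {b} {y} x≈ab+y a≈0 = begin
    x           ≈⟨ x≈ab+y ⟩
    a * b + y   ≈⟨ +-congʳ (zero-factor b a≈0) ⟩
    0# + y      ≈⟨ +-identityˡ y ⟩
    y           ∎

  -- In the plane, a vector orthogonal to two nonzero orthogonal vectors
  -- is zero.  Binet–Cauchy gives (u×v)² = |u|²|v|² ≠ 0, then u×w = 0,
  -- and finally |u|²|w|² = (u·w)² + (u×w)² = 0.
  orthogonal-to-orthogonal-pair : ∀ u v w → ¬ u ≋ 𝟎 → ¬ v ≋ 𝟎 →
    u ∙ v ≈ 0# → u ∙ w ≈ 0# → v ∙ w ≈ 0# → w ≋ 𝟎
  orthogonal-to-orthogonal-pair u v w u≉0 v≉0 u∙v≈0 u∙w≈0 v∙w≈0 =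
    norm²-zero w (cancel-nonzero |u|²|w|²≈0 |u|²≉0)
    where
    |u|²≉0 : ¬ ∣ u ∣² ≈ 0#
    |u|²≉0 |u|²≈0 = u≉0 (norm²-zero u |u|²≈0)
    u×v≉0 : ¬ cross u v ≈ 0#
    u×v≉0 u×v≈0 = nonzero-product |u|²≉0 (λ |v|²≈0 → v≉0 (norm²-zero v |v|²≈0)) (begin
      ∣ u ∣² * ∣ v ∣²          ≈⟨ drop-zero-term (binet-cauchy u v v) u∙v≈0 ⟩
      cross u v * cross u v    ≈⟨ zero-factor (cross u v) u×v≈0 ⟩
      0#                       ∎)
    u×w≈0 : cross u w ≈ 0#
    u×w≈0 = cancel-nonzero (begin
      cross u v * cross u w    ≈⟨ drop-zero-term (binet-cauchy u v w) u∙v≈0 ⟨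
      ∣ u ∣² * (v ∙ w)         ≈⟨ *-congˡ v∙w≈0 ⟩
      ∣ u ∣² * 0#              ≈⟨ zeroʳ ∣ u ∣² ⟩
      0#                       ∎) u×v≉0
    |u|²|w|²≈0 : ∣ u ∣² * ∣ w ∣² ≈ 0#
    |u|²|w|²≈0 = begin
      ∣ u ∣² * ∣ w ∣²          ≈⟨ drop-zero-term (binet-cauchy u w w) u∙w≈0 ⟩
      cross u w * cross u w    ≈⟨ zero-factor (cross u w) u×w≈0 ⟩
      0#                       ∎

  -- For a quadrilateral PQRS with diagonals u = R - P, v = S - Q and
  -- w = (Q - P) - (R - S), twice each of u·v, u·w, v·w is a combination of
  -- differences of squared side lengths.
  diagonals-identity : ∀ P Q R S → let u = R ⊖ P; v = S ⊖ Q in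
    u ∙ v + u ∙ v ≈ (∣ Q ⊖ R ∣² - ∣ P ⊖ Q ∣²) + (∣ S ⊖ P ∣² - ∣ R ⊖ S ∣²)
  diagonals-identity (p₁ , p₂) (q₁ , q₂) (r₁ , r₂) (s₁ , s₂) =
    solve 8 (λ p₁ p₂ q₁ q₂ r₁ r₂ s₁ s₂ →
      let P = (p₁ , p₂); Q = (q₁ , q₂); R = (r₁ , r₂); S = (s₁ , s₂)
          u = R ⊖′ P; v = S ⊖′ Q in
      (u ∙′ v) :+ (u ∙′ v) := (∣ Q ⊖′ R ∣²′ :+ (:- ∣ P ⊖′ Q ∣²′)) :+ (∣ S ⊖′ P ∣²′ :+ (:- ∣ R ⊖′ S ∣²′)))
      refl p₁ p₂ q₁ q₂ r₁ r₂ s₁ s₂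
    where open Symbolic 8 using () renaming (_⊖_ to _⊖′_; _∙_ to _∙′_; ∣_∣² to ∣_∣²′)

  first-diagonal-identity : ∀ P Q R S → let u = R ⊖ P; w = (Q ⊖ P) ⊖ (R ⊖ S) in
    u ∙ w + u ∙ w ≈ (∣ P ⊖ Q ∣² - ∣ Q ⊖ R ∣²) + (∣ S ⊖ P ∣² - ∣ R ⊖ S ∣²)
  first-diagonal-identity (p₁ , p₂) (q₁ , q₂) (r₁ , r₂) (s₁ , s₂) =
    solve 8 (λ p₁ p₂ q₁ q₂ r₁ r₂ s₁ s₂ →
      let P = (p₁ , p₂); Q = (q₁ , q₂); R = (r₁ , r₂); S = (s₁ , s₂)
          u = R ⊖′ P; w = (Q ⊖′ P) ⊖′ (R ⊖′ S) in
      (u ∙′ w) :+ (u ∙′ w) := (∣ P ⊖′ Q ∣²′ :+ (:- ∣ Q ⊖′ R ∣²′)) :+ (∣ S ⊖′ P ∣²′ :+ (:- ∣ R ⊖′ S ∣²′)))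
      refl p₁ p₂ q₁ q₂ r₁ r₂ s₁ s₂
    where open Symbolic 8 using () renaming (_⊖_ to _⊖′_; _∙_ to _∙′_; ∣_∣² to ∣_∣²′)

  second-diagonal-identity : ∀ P Q R S → let v = S ⊖ Q; w = (Q ⊖ P) ⊖ (R ⊖ S) in
    v ∙ w + v ∙ w ≈ (∣ S ⊖ P ∣² - ∣ P ⊖ Q ∣²) + (∣ R ⊖ S ∣² - ∣ Q ⊖ R ∣²)
  second-diagonal-identity (p₁ , p₂) (q₁ , q₂) (r₁ , r₂) (s₁ , s₂) =
    solve 8 (λ p₁ p₂ q₁ q₂ r₁ r₂ s₁ s₂ →
      let P = (p₁ , p₂); Q = (q₁ , q₂); R = (r₁ , r₂); S = (s₁ , s₂)
          v = S ⊖′ Q; w = (Q ⊖′ P) ⊖′ (R ⊖′ S) in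
      (v ∙′ w) :+ (v ∙′ w) := (∣ S ⊖′ P ∣²′ :+ (:- ∣ P ⊖′ Q ∣²′)) :+ (∣ R ⊖′ S ∣²′ :+ (:- ∣ Q ⊖′ R ∣²′)))
      refl p₁ p₂ q₁ q₂ r₁ r₂ s₁ s₂
    where open Symbolic 8 using () renaming (_⊖_ to _⊖′_; _∙_ to _∙′_; ∣_∣² to ∣_∣²′)

  equal-sides : ∀ {a b e f d} → a ≈ d → b ≈ d → e ≈ d → f ≈ d → (a - b) + (e - f) ≈ 0#
  equal-sides a≈d b≈d e≈d f≈d =
    trans (+-cong (x≈y⇒x∙y⁻¹≈ε (trans a≈d (sym b≈d))) (x≈y⇒x∙y⁻¹≈ε (trans e≈d (sym f≈d))))
          (+-identityʳ 0#)

  rhombus : ∀ {d} P Q R S →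
    ∣ P ⊖ Q ∣² ≈ d → ∣ Q ⊖ R ∣² ≈ d → ∣ R ⊖ S ∣² ≈ d → ∣ S ⊖ P ∣² ≈ d →
    ¬ P ≋ R → ¬ Q ≋ S → Q ⊖ P ≋ R ⊖ S
  rhombus P Q R S PQ QR RS SP P≉R Q≉S =
    difference-zero (Q ⊖ P) (R ⊖ S)
      (orthogonal-to-orthogonal-pair (R ⊖ P) (S ⊖ Q) ((Q ⊖ P) ⊖ (R ⊖ S))
        (λ u≈0 → P≉R (≋-sym (difference-zero R P u≈0)))
        (λ v≈0 → Q≉S (≋-sym (difference-zero S Q v≈0)))
        (half-zero (trans (diagonals-identity P Q R S) (equal-sides QR PQ SP RS)))
        (half-zero (trans (first-diagonal-identity P Q R S) (equal-sides PQ QR SP RS)))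
        (half-zero (trans (second-diagonal-identity P Q R S) (equal-sides SP PQ RS QR))))

  opposite-translations : ∀ P Q R S → Q ⊖ P ≋ R ⊖ S → Q ⊖ P ≋ S ⊖ R → P ≋ Q
  opposite-translations (p₁ , p₂) (q₁ , q₂) (r₁ , r₂) (s₁ , s₂) (e₁ , e₂) (f₁ , f₂) =
    ≋-sym (difference-zero (q₁ , q₂) (p₁ , p₂) (coordinate e₁ f₁ , coordinate e₂ f₂))
    where
    coordinate : ∀ {p q r s} → q - p ≈ r - s → q - p ≈ s - r → q - p ≈ 0#
    coordinate {p} {q} {r} {s} e f = half-zero (begin
      (q - p) + (q - p)   ≈⟨ +-cong e f ⟩
      (r - s) + (s - r)   ≈⟨ opposite-sum r s ⟩
      0#                  ∎)
      where
      opposite-sum : ∀ r s → (r - s) + (s - r) ≈ 0#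
      opposite-sum = solve 2 (λ r s → (r :+ (:- s)) :+ (s :+ (:- r)) := con (+ 0)) refl

module UnitDistanceEmbedding {c ℓ₁ ℓ₂} (R : RealField c ℓ₁ ℓ₂) {n} (G : Graph n)
                             (embedding : UnitDistance R G) where
  open EuclideanPlane R
  open Graph G using (Adj)
  open RealField R using (_≈_; 1#)

  φ : Fin n → Vector
  φ = proj₁ embedding

  injective : ∀ v w → φ v ≋ φ w → v ≡ w
  injective = proj₁ (proj₂ embedding)

  unit : ∀ v w → Adj v w → ∣ φ v ⊖ φ w ∣² ≈ 1#
  unit = proj₂ (proj₂ embedding)

  four-cycle-parallelogram : ∀ p q r s → Adj p q → Adj q r → Adj r s → Adj s p →
    ¬ p ≡ r → ¬ q ≡ s → φ q ⊖ φ p ≋ φ r ⊖ φ s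
  four-cycle-parallelogram p q r s pq qr rs sp p≢r q≢s =
    rhombus (φ p) (φ q) (φ r) (φ s) (unit p q pq) (unit q r qr) (unit r s rs) (unit s p sp)
      (distinct p r p≢r) (distinct q s q≢s)
    where
    distinct : ∀ v w → ¬ v ≡ w → ¬ φ v ≋ φ w
    distinct v w v≢w φv≋φw = v≢w (injective v w φv≋φw)

-- Adjacency in F(8,12,3) is decided by searching the edge list, so edges
-- can be certified by computation.
adjacent? : ∀ v w → Dec (F-Adj v w)
adjacent? v w = ((v , w) ∈? F-8-12-3-edges) ⊎-dec ((w , v) ∈? F-8-12-3-edges)
  where open Data.List.Membership.DecPropositional (≡-dec Fin._≟_ Fin._≟_) using (_∈?_)

edge : ∀ v w → {True (adjacent? v w)} → F-Adj v w
edge v w {adjacent} = toWitness adjacent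

-- The three rhombi 1243, 3465, 5687 make the edge 78 a translate of 12,
-- while the rhombus 1278 makes it the opposite translate; so vertices 1
-- and 2 would coincide.
mainTheorem4 : ∀ {c ℓ₁ ℓ₂} (R : RealField c ℓ₁ ℓ₂) → Forbidden R F-8-12-3
mainTheorem4 R embedding =
  v1≢v2 (injective v1 v2 (opposite-translations (φ v1) (φ v2) (φ v8) (φ v7) ladder closing))
  where
  open EuclideanPlane R
  open UnitDistanceEmbedding R F-8-12-3 embedding

  v1≢v2 : ¬ v1 ≡ v2
  v1≢v2 ()

  ladder : φ v2 ⊖ φ v1 ≋ φ v8 ⊖ φ v7
  ladder =
    ≋-trans (four-cycle-parallelogram v1 v2 v4 v3 (edge v1 v2) (edge v2 v4) (edge v4 v3) (edge v3 v1) (λ ()) (λ ()))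
   (≋-trans (four-cycle-parallelogram v3 v4 v6 v5 (edge v3 v4) (edge v4 v6) (edge v6 v5) (edge v5 v3) (λ ()) (λ ()))
            (four-cycle-parallelogram v5 v6 v8 v7 (edge v5 v6) (edge v6 v8) (edge v8 v7) (edge v7 v5) (λ ()) (λ ())))

  closing : φ v2 ⊖ φ v1 ≋ φ v7 ⊖ φ v8
  closing = four-cycle-parallelogram v1 v2 v7 v8 (edge v1 v2) (edge v2 v7) (edge v7 v8) (edge v8 v1) (λ ()) (λ ())
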